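{- Let $p$ be a prime, let $\mathcal M$ be an arbitrary subset of $\mathbb F_p^*$ with $|\mathcal M|=M$ elements, and let $N$ be an integer with $2\leqslant N<p$. Let $\mathcal I=\{1,2,\ldots,N\}\pmod p\subset\mathbb F_p^*$ and $\mathcal I\cdot\mathcal M=\{xm:\ x\in\mathcal I,\ m\in\mathcal M\}\subset\mathbb F_p^*$. Then $$|\mathcal I\cdot\mathcal M|\gg \min\Bigl\{\frac{p}{\log^2 N},\ \frac{N^2}{\log^2 N},\ \frac{NM}{\log N}\Bigr\},$$ where the implied constant is absolute.
   Context: $|X|$ denotes the cardinality of a set $X$. $U\gg V$ means $U\geqslant cV$ for some absolute constant $c>0$. -}

module Defs where

open import Data.Bool using (Bool; true; false; _∧_)
open import Data.Nat using (ℕ; suc; NonZero)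
open import Data.Nat.DivMod using (_mod_)
open import Data.Fin using (Fin; toℕ; _≟_)
open import Data.Fin.Subset using (Subset)
open import Data.List using (List; applyUpTo; allFin)
open import Data.Bool.ListAction using (any)
open import Data.Vec using (tabulate; lookup)
open import Relation.Nullary.Decidable using (⌊_⌋)
import Data.Nat as N

-- Elements of F_p are represented by Fin p (residues 0..p-1);
-- a subset of F_p is a Subset p (= Vec Bool p, true = inside).

allF : (p : ℕ) → List (Fin p)
allF p = allFin p

-- I·M = { x m mod p : x ∈ {1,…,N}, m ∈ M }, as a subset of F_p.
prodSet : (p N : ℕ) .{{_ : NonZero p}} → Subset p → Subset p
prodSet p N M = tabulate λ z →
  any (λ x → any (λ m → lookup M m ∧ ⌊ z ≟ ((x N.* toℕ m) mod p) ⌋) (allF p))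
      (applyUpTo suc N)

-- Let A be the set of primes up to N. Chebyshev's argument gives |A| = π(N) ≥ N / (6 log₂ N): the
-- central binomial coefficient C(2n, n) ≥ 2ⁿ is a product of prime powers each at most 2n.
-- For y ∈ M the dilate A·y lies in I·M and has π(N) elements. Two dilates A·y, A·y′ with y ≠ y′
-- meet in at most K = ⌊4N²/p⌋ + 1 points. Indeed a common point is a pair with q₁y = q₂y′, and two
-- such pairs whose ratios q₁/(q₁+q₂) lie in the same of K subintervals of [0, 1] satisfy
-- q₁q₂′ ≡ q₁′q₂ (mod p) with |q₁q₂′ − q₁′q₂| < 4N²/K < p; so q₁q₂′ = q₁′q₂, and as all four are
-- primes the pairs coincide. By Bonferroni, r ≤ |M| dilates give |I·M| ≥ rπ(N) − r²K. With
-- r = min(|M|, ⌊π(N)/2K⌋) this is |I·M| ≥ |M|π(N)/2 when r = |M|, and otherwise π(N)² ≤ 8K|I·M|,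
-- which bounds min(p, N²) because K·min(p, N²) ≤ 5N².

module Submission where

open import Defs
open import Data.Nat using (ℕ; NonZero; _*_; _≤_; _<_; _⊓_)
open import Data.Nat.Primality using (Prime)
open import Data.Nat.Logarithm using (⌊log₂_⌋)
open import Data.Fin using (toℕ)
open import Data.Fin.Subset using (Subset; _∈_; ∣_∣)
open import Data.Product using (∃-syntax)
open import Relation.Binary.PropositionalEquality using (_≢_)

open import Data.Bool.Properties using (T-≡; T-∧)
open import Data.Fin using (Fin; zero; suc) renaming (_≟_ to _≟ᶠ_)
open import Data.Fin.Properties using (toℕ-fromℕ<; toℕ<n; toℕ-injective; fromℕ<-injective)
open import Data.Fin.Subset using (inside; outside; _∉_; _⊆_; _∪_; _∩_; ⋃; ⁅_⁆; ⊥; Nonempty)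
open import Data.Fin.Subset.Properties
  using ( ∣⊥∣≡0; ∣⁅x⁆∣≡1; ∉⊥; x∈⁅x⁆; x∈⁅y⁆⇒x≡y; x∈p∪q⁺; x∈p∪q⁻; x∈p∩q⁻; q⊆p∪q; ∩-zeroʳ; ∩-distribˡ-∪
        ; p⊆q⇒∣p∣≤∣q∣; p⊂q⇒∣p∣<∣q∣; ∣p∣≤n; _∈?_)
open import Data.List using (List; []; _∷_; length; map; filter; take; allFin; upTo; applyUpTo; cartesianProduct)
open import Data.List.Membership.Propositional using (lose) renaming (_∈_ to _∈ₗ_)
open import Data.List.Membership.Propositional.Properties
  using (∈-filter⁺; ∈-filter⁻; ∈-allFin; ∈-upTo⁺; ∈-upTo⁻; ∈-applyUpTo⁺; ∈-cartesianProduct⁺; ∈-cartesianProduct⁻)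
open import Data.List.Properties using (filter-accept; filter-reject; length-map; length-take)
open import Data.List.Relation.Unary.All as All using (All; []; _∷_)
import Data.List.Relation.Unary.All.Properties as All
open import Data.List.Relation.Unary.AllPairs using (AllPairs; []; _∷_)
import Data.List.Relation.Unary.AllPairs.Properties as AllPairs
open import Data.List.Relation.Unary.Any using (here; there)
open import Data.List.Relation.Unary.Any.Properties using (any⁺)
open import Data.List.Relation.Unary.Unique.Propositional using (Unique)
import Data.List.Relation.Unary.Unique.Propositional.Properties as Unique
open import Data.Nat
open import Data.Nat.Combinatorics using (_C_; k![n∸k]!∣n!)
open import Data.Nat.Combinatorics.Specification using (nCk≡n!/k![n-k]!)
open import Data.Nat.Coprimality using (coprime-divisor; prime⇒coprime)
open import Data.Nat.DivMod
  using (_/_; _%_; _mod_; m≡m%n+[m/n]*n; m%n<n; m/n*n≤m; m/n*n≡m; m≥n⇒m/n>0; m<n⇒m%n≡m; m<n*o⇒m/o<n; %-distribˡ-*)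
open import Data.Nat.Divisibility
open import Data.Nat.Induction using (<-wellFounded)
open import Data.Nat.ListAction using (product)
open import Data.Nat.ListAction.Properties using (∈⇒∣product)
open import Data.Nat.Logarithm using (⌊log₂⌋-mono-≤; ⌊log₂[2^n]⌋≡n)
open import Data.Nat.Primality
open import Data.Nat.Primality.Factorisation using (PrimeFactorisation; factorise)
open import Data.Nat.Properties
open import Algebra.Properties.CommutativeSemigroup *-commutativeSemigroup using (x∙yz≈y∙xz)
open import Data.Nat.Solver using (module +-*-Solver)
open import Data.Product using (_×_; _,_; proj₁; proj₂)
open import Data.Sum using (inj₁; inj₂)
open import Data.Vec using ([]; _∷_; here; there)
open import Data.Vec.Properties using (lookup∘tabulate; lookup⇒[]=; []=⇒lookup)
open import Function using (_∘_; id; Equivalence)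
open import Induction.WellFounded using (Acc; acc)
open import Relation.Binary.PropositionalEquality
open import Relation.Nullary using (¬_; Dec; yes; no; ¬?; contradiction)
open import Relation.Nullary.Decidable using (fromWitness)

open +-*-Solver

private variable
  n : ℕ

-- Counting in finite sets

∣p∪q∣+∣p∩q∣≡∣p∣+∣q∣ : ∀ (p q : Subset n) → ∣ p ∪ q ∣ + ∣ p ∩ q ∣ ≡ ∣ p ∣ + ∣ q ∣
∣p∪q∣+∣p∩q∣≡∣p∣+∣q∣ [] [] = refl
∣p∪q∣+∣p∩q∣≡∣p∣+∣q∣ (inside ∷ p) (inside ∷ q) = cong suc (begin
  ∣ p ∪ q ∣ + suc ∣ p ∩ q ∣   ≡⟨ +-suc _ _ ⟩
  suc (∣ p ∪ q ∣ + ∣ p ∩ q ∣) ≡⟨ cong suc (∣p∪q∣+∣p∩q∣≡∣p∣+∣q∣ p q) ⟩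
  suc (∣ p ∣ + ∣ q ∣)         ≡⟨ +-suc _ _ ⟨
  ∣ p ∣ + suc ∣ q ∣           ∎)
  where open ≡-Reasoning
∣p∪q∣+∣p∩q∣≡∣p∣+∣q∣ (inside ∷ p) (outside ∷ q) = cong suc (∣p∪q∣+∣p∩q∣≡∣p∣+∣q∣ p q)
∣p∪q∣+∣p∩q∣≡∣p∣+∣q∣ (outside ∷ p) (inside ∷ q) =
  trans (cong suc (∣p∪q∣+∣p∩q∣≡∣p∣+∣q∣ p q)) (sym (+-suc _ _))
∣p∪q∣+∣p∩q∣≡∣p∣+∣q∣ (outside ∷ p) (outside ∷ q) = ∣p∪q∣+∣p∩q∣≡∣p∣+∣q∣ p q

∣p∪q∣≤∣p∣+∣q∣ : ∀ (p q : Subset n) → ∣ p ∪ q ∣ ≤ ∣ p ∣ + ∣ q ∣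
∣p∪q∣≤∣p∣+∣q∣ p q = ≤-trans (m≤m+n _ _) (≤-reflexive (∣p∪q∣+∣p∩q∣≡∣p∣+∣q∣ p q))

∣p∩⋃qs∣≤length[qs]*d : ∀ {d} p (qs : List (Subset n)) →
                       All (λ q → ∣ p ∩ q ∣ ≤ d) qs → ∣ p ∩ ⋃ qs ∣ ≤ length qs * d
∣p∩⋃qs∣≤length[qs]*d {n} p [] [] = ≤-reflexive (trans (cong ∣_∣ (∩-zeroʳ p)) (∣⊥∣≡0 n))
∣p∩⋃qs∣≤length[qs]*d {d = d} p (q ∷ qs) (pq≤d ∷ pqs≤d) = begin
  ∣ p ∩ (q ∪ ⋃ qs) ∣           ≡⟨ cong ∣_∣ (∩-distribˡ-∪ p q (⋃ qs)) ⟩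
  ∣ (p ∩ q) ∪ (p ∩ ⋃ qs) ∣     ≤⟨ ∣p∪q∣≤∣p∣+∣q∣ (p ∩ q) (p ∩ ⋃ qs) ⟩
  ∣ p ∩ q ∣ + ∣ p ∩ ⋃ qs ∣     ≤⟨ +-mono-≤ pq≤d (∣p∩⋃qs∣≤length[qs]*d p qs pqs≤d) ⟩
  d + length qs * d            ∎
  where open ≤-Reasoning

bonferroni : ∀ {k d} (ps : List (Subset n)) →
             All (λ p → k ≤ ∣ p ∣) ps → AllPairs (λ p q → ∣ p ∩ q ∣ ≤ d) ps →
             length ps * k ≤ ∣ ⋃ ps ∣ + length ps * (length ps * d)
bonferroni [] [] [] = z≤n
bonferroni {k = k} {d = d} (p ∷ ps) (k≤∣p∣ ∷ k≤∣ps∣) (p∩ps≤d ∷ ps∩ps≤d) = begin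
  k + r * k                                   ≤⟨ +-mono-≤ k≤∣p∣ (bonferroni ps k≤∣ps∣ ps∩ps≤d) ⟩
  ∣ p ∣ + (∣ ⋃ ps ∣ + r * (r * d))            ≡⟨ +-assoc ∣ p ∣ _ _ ⟨
  ∣ p ∣ + ∣ ⋃ ps ∣ + r * (r * d)              ≡⟨ cong (_+ r * (r * d)) (∣p∪q∣+∣p∩q∣≡∣p∣+∣q∣ p (⋃ ps)) ⟨
  ∣ p ∪ ⋃ ps ∣ + ∣ p ∩ ⋃ ps ∣ + r * (r * d)  ≤⟨ +-monoˡ-≤ (r * (r * d)) (+-monoʳ-≤ ∣ p ∪ ⋃ ps ∣ ∣p∩⋃ps∣≤r*d) ⟩
  ∣ p ∪ ⋃ ps ∣ + r * d + r * (r * d)          ≡⟨ +-assoc ∣ p ∪ ⋃ ps ∣ _ _ ⟩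
  ∣ p ∪ ⋃ ps ∣ + (r * d + r * (r * d))        ≤⟨ +-monoʳ-≤ ∣ p ∪ ⋃ ps ∣ grow ⟩
  ∣ p ∪ ⋃ ps ∣ + suc r * (suc r * d)          ∎
  where
  open ≤-Reasoning
  r = length ps
  ∣p∩⋃ps∣≤r*d : ∣ p ∩ ⋃ ps ∣ ≤ r * d
  ∣p∩⋃ps∣≤r*d = ∣p∩⋃qs∣≤length[qs]*d p ps p∩ps≤d
  grow : r * d + r * (r * d) ≤ suc r * (suc r * d)
  grow = ≤-trans (m≤n+m _ (d + r * d))
                 (≤-reflexive (solve 2 (λ r d → d :+ r :* d :+ (r :* d :+ r :* (r :* d))
                                             := (con 1 :+ r) :* ((con 1 :+ r) :* d)) refl r d))

module _ {a} {A : Set a} {n : ℕ} where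

  image : (A → Fin n) → List A → Subset n
  image f xs = ⋃ (map (⁅_⁆ ∘ f) xs)

  ∈-image⁺ : ∀ (f : A → Fin n) {x xs} → x ∈ₗ xs → f x ∈ image f xs
  ∈-image⁺ f {xs = y ∷ ys} (here refl) = x∈p∪q⁺ (inj₁ (x∈⁅x⁆ (f y)))
  ∈-image⁺ f {xs = y ∷ ys} (there x∈ys) = x∈p∪q⁺ (inj₂ (∈-image⁺ f x∈ys))

  ∈-image⁻ : ∀ (f : A → Fin n) xs {z} → z ∈ image f xs → ∃[ x ] x ∈ₗ xs × z ≡ f x
  ∈-image⁻ f [] z∈⊥ = contradiction z∈⊥ ∉⊥
  ∈-image⁻ f (x ∷ xs) z∈ with x∈p∪q⁻ ⁅ f x ⁆ (image f xs) z∈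
  ... | inj₁ z∈⁅fx⁆ = x , here refl , x∈⁅y⁆⇒x≡y (f x) z∈⁅fx⁆
  ... | inj₂ z∈img  = let (y , y∈xs , z≡fy) = ∈-image⁻ f xs z∈img in y , there y∈xs , z≡fy

  ∣image∣≤length : ∀ (f : A → Fin n) xs → ∣ image f xs ∣ ≤ length xs
  ∣image∣≤length f [] = ≤-reflexive (∣⊥∣≡0 n)
  ∣image∣≤length f (x ∷ xs) = begin
    ∣ ⁅ f x ⁆ ∪ image f xs ∣        ≤⟨ ∣p∪q∣≤∣p∣+∣q∣ ⁅ f x ⁆ (image f xs) ⟩
    ∣ ⁅ f x ⁆ ∣ + ∣ image f xs ∣    ≡⟨ cong (_+ ∣ image f xs ∣) (∣⁅x⁆∣≡1 (f x)) ⟩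
    suc ∣ image f xs ∣              ≤⟨ s≤s (∣image∣≤length f xs) ⟩
    suc (length xs)                 ∎
    where open ≤-Reasoning

  length≤∣image∣ : ∀ (f : A → Fin n) {xs} → Unique xs →
                   (∀ {x y} → x ∈ₗ xs → y ∈ₗ xs → f x ≡ f y → x ≡ y) →
                   length xs ≤ ∣ image f xs ∣
  length≤∣image∣ f [] _ = z≤n
  length≤∣image∣ f {x ∷ xs} (x∉xs ∷ xs!) f-inj =
    ≤-trans (s≤s (length≤∣image∣ f xs! (λ u v → f-inj (there u) (there v))))
            (p⊂q⇒∣p∣<∣q∣ (q⊆p∪q ⁅ f x ⁆ (image f xs) , f x , x∈p∪q⁺ (inj₁ (x∈⁅x⁆ (f x))) , fx∉img))
    where
    fx∉img : f x ∉ image f xs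
    fx∉img fx∈img with ∈-image⁻ f xs fx∈img
    ... | y , y∈xs , fx≡fy = All.lookup x∉xs y∈xs (f-inj (here refl) (there y∈xs) fx≡fy)

⋃-least : ∀ {ps : List (Subset n)} {q} → All (_⊆ q) ps → ⋃ ps ⊆ q
⋃-least [] x∈⊥ = contradiction x∈⊥ ∉⊥
⋃-least {ps = p ∷ ps} (p⊆q ∷ ps⊆q) x∈p∪⋃ps with x∈p∪q⁻ p (⋃ ps) x∈p∪⋃ps
... | inj₁ x∈p   = p⊆q x∈p
... | inj₂ x∈⋃ps = ⋃-least ps⊆q x∈⋃ps

0<∣p∣⇒nonempty : ∀ {p : Subset n} → 0 < ∣ p ∣ → Nonempty p
0<∣p∣⇒nonempty {p = inside  ∷ _} _     = zero , here
0<∣p∣⇒nonempty {p = outside ∷ p} 0<∣p∣ with x , x∈p ← 0<∣p∣⇒nonempty {p = p} 0<∣p∣ = suc x , there x∈p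

elements : Subset n → List (Fin n)
elements p = filter (_∈? p) (allFin _)

elements-unique : ∀ (p : Subset n) → Unique (elements p)
elements-unique p = Unique.filter⁺ (_∈? p) (Unique.allFin⁺ _)

∈-elements⁻ : ∀ {p : Subset n} {x} → x ∈ₗ elements p → x ∈ p
∈-elements⁻ {p = p} x∈ = proj₂ (∈-filter⁻ (_∈? p) {xs = allFin _} x∈)

length-elements : ∀ (p : Subset n) → length (elements p) ≡ ∣ p ∣
length-elements p = ≤-antisym
  (≤-trans (length≤∣image∣ id (elements-unique p) (λ _ _ x≡y → x≡y)) (p⊆q⇒∣p∣≤∣q∣ image⊆p))
  (≤-trans (p⊆q⇒∣p∣≤∣q∣ p⊆image) (∣image∣≤length id (elements p)))
  where
  image⊆p : image id (elements p) ⊆ p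
  image⊆p x∈ with ∈-image⁻ id (elements p) x∈
  ... | _ , y∈ , refl = ∈-elements⁻ y∈
  p⊆image : p ⊆ image id (elements p)
  p⊆image {x} x∈p = ∈-image⁺ id (∈-filter⁺ (_∈? p) (∈-allFin x) x∈p)

-- Chebyshev's lower bound for π

primesUpTo : ℕ → List ℕ
primesUpTo N = filter prime? (upTo (suc N))

π : ℕ → ℕ
π N = length (primesUpTo N)

∈-primesUpTo⁺ : ∀ {N p} → Prime p → p ≤ N → p ∈ₗ primesUpTo N
∈-primesUpTo⁺ p-prime p≤N = ∈-filter⁺ prime? (∈-upTo⁺ (s≤s p≤N)) p-prime

∈-primesUpTo⁻ : ∀ {N p} → p ∈ₗ primesUpTo N → Prime p × p ≤ N
∈-primesUpTo⁻ {N} p∈ with ∈-filter⁻ prime? {xs = upTo (suc N)} p∈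
... | p∈upTo , p-prime = p-prime , s≤s⁻¹ (∈-upTo⁻ p∈upTo)

primesUpTo-unique : ∀ N → Unique (primesUpTo N)
primesUpTo-unique N = Unique.filter⁺ prime? (Unique.upTo⁺ (suc N))

2^n*n!*n!≤[n+n]! : ∀ n → 2 ^ n * (n ! * n !) ≤ (n + n) !
2^n*n!*n!≤[n+n]! zero = ≤-refl
2^n*n!*n!≤[n+n]! (suc n) = begin
  2 ^ suc n * (suc n ! * suc n !)
    ≡⟨ solve 3 (λ n t f → con 2 :* t :* ((con 1 :+ n) :* f :* ((con 1 :+ n) :* f))
                       := ((con 1 :+ n) :+ (con 1 :+ n)) :* ((con 1 :+ n) :* (t :* (f :* f))))
               refl n (2 ^ n) (n !) ⟩
  (suc n + suc n) * (suc n * (2 ^ n * (n ! * n !)))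
    ≤⟨ *-monoʳ-≤ (suc n + suc n) (*-mono-≤ (s≤s (m≤m+n n n)) (2^n*n!*n!≤[n+n]! n)) ⟩
  (suc n + suc n) * (suc (n + n) * (n + n) !)
    ≡⟨ cong (λ m → (suc n + suc n) * m !) (+-suc n n) ⟨
  (suc n + suc n) !
    ∎
  where open ≤-Reasoning

[n+n]Cn*n!*n!≡[n+n]! : ∀ n → ((n + n) C n) * (n ! * n !) ≡ (n + n) !
[n+n]Cn*n!*n!≡[n+n]! n = begin
  ((n + n) C n) * (n ! * n !)
    ≡⟨ cong (λ m → ((n + n) C n) * (n ! * m !)) (m+n∸m≡n n n) ⟨
  ((n + n) C n) * (n ! * (n + n ∸ n) !)
    ≡⟨ cong (_* (n ! * (n + n ∸ n) !)) (nCk≡n!/k![n-k]! (m≤m+n n n)) ⟩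
  (n + n) ! / (n ! * (n + n ∸ n) !) * (n ! * (n + n ∸ n) !)
    ≡⟨ m/n*n≡m (k![n∸k]!∣n! (m≤m+n n n)) ⟩
  (n + n) !
    ∎
  where
  open ≡-Reasoning
  instance _ = n !* (n + n ∸ n) !≢0

b!*c!∣[b+c+e]! : ∀ b c e → b ! * c ! ∣ (b + c + e) !
b!*c!∣[b+c+e]! b c e = ∣-trans (subst (λ m → b ! * m ! ∣ (b + c) !) (m+n∸m≡n b c) (k![n∸k]!∣n! (m≤m+n b c)))
                               (m≤n⇒m!∣n! (m≤m+n (b + c) e))

module _ {q : ℕ} (q-prime : Prime q) where

  private
    instance
      q≢0 : NonZero q
      q≢0 = prime⇒nonZero q-prime

    1<q : 1 < q
    1<q = nonTrivial⇒n>1 q {{prime⇒nonTrivial q-prime}}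

    q∤1 : ¬ q ∣ 1
    q∤1 q∣1 = ¬prime[1] (subst Prime (∣1⇒≡1 q∣1) q-prime)

  record ⌊_/q⌋≡_ (a t : ℕ) : Set where
    constructor _,_
    field
      lower : t * q ≤ a
      upper : a < suc t * q

  ∤-between-multiples : ∀ {t m} → t * q < m → m < suc t * q → ¬ q ∣ m
  ∤-between-multiples {t} lo hi (divides w refl) = <⇒≱ hi (*-monoˡ-≤ q (*-cancelʳ-< q t w lo))

  q^j∣m*r⇒q^j∣m : ∀ j m {r} → ¬ q ∣ r → q ^ j ∣ m * r → q ^ j ∣ m
  q^j∣m*r⇒q^j∣m zero m _ _ = 1∣ m
  q^j∣m*r⇒q^j∣m (suc j) m {r} q∤r q^[1+j]∣mr with euclidsLemma m r q-prime (m*n∣⇒m∣ q (q ^ j) q^[1+j]∣mr)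
  ... | inj₂ q∣r = contradiction q∣r q∤r
  ... | inj₁ (divides m′ refl) = subst (q * q ^ j ∣_) (*-comm q m′) (*-monoʳ-∣ q q^j∣m′)
    where
    m′qr≡q[m′r] : m′ * q * r ≡ q * (m′ * r)
    m′qr≡q[m′r] = trans (cong (_* r) (*-comm m′ q)) (*-assoc q m′ r)
    q^j∣m′ : q ^ j ∣ m′
    q^j∣m′ = q^j∣m*r⇒q^j∣m j m′ q∤r (*-cancelˡ-∣ q (subst (q * q ^ j ∣_) m′qr≡q[m′r] q^[1+j]∣mr))

  -- The multiples q, 2q, …, tq of q up to a contribute q ^ t * t !.
  record FactorialSplit (a : ℕ) : Set where
    constructor split
    field
      t R   : ℕ
      floor : ⌊ a /q⌋≡ t
      a!≡   : a ! ≡ q ^ t * (t ! * R)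
      q∤R   : ¬ q ∣ R

  factorialSplit : ∀ a → FactorialSplit a
  factorialSplit zero = split 0 1 (z≤n , subst (0 <_) (sym (*-identityˡ q)) (>-nonZero⁻¹ q)) refl q∤1
  factorialSplit (suc a) with factorialSplit a
  ... | split t R (lo , hi) a!≡ q∤R with suc a ≟ suc t * q
  ...   | yes 1+a≡ = split (suc t) R (≤-reflexive (sym 1+a≡) , a<1+t+1) [1+a]!≡ q∤R
    where
    a<1+t+1 : suc a < suc (suc t) * q
    a<1+t+1 = subst (_< suc (suc t) * q) (sym 1+a≡) (m<n+m (suc t * q) (>-nonZero⁻¹ q))
    [1+a]!≡ : suc a ! ≡ q ^ suc t * (suc t ! * R)
    [1+a]!≡ = begin
      suc a * a !
        ≡⟨ cong₂ _*_ 1+a≡ a!≡ ⟩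
      suc t * q * (q ^ t * (t ! * R))
        ≡⟨ solve 5 (λ t q x f r → (con 1 :+ t) :* q :* (x :* (f :* r)) := q :* x :* ((con 1 :+ t) :* f :* r))
                   refl t q (q ^ t) (t !) R ⟩
      q * q ^ t * (suc t * t ! * R)
        ∎
      where open ≡-Reasoning
  ...   | no 1+a≢ = split t (suc a * R) (≤-trans lo (n≤1+n a) , ≤∧≢⇒< hi 1+a≢) [1+a]!≡ q∤[1+a]R
    where
    [1+a]!≡ : suc a ! ≡ q ^ t * (t ! * (suc a * R))
    [1+a]!≡ = trans (cong (suc a *_) a!≡)
                    (solve 4 (λ s x f r → s :* (x :* (f :* r)) := x :* (f :* (s :* r)))
                             refl (suc a) (q ^ t) (t !) R)
    q∤[1+a]R : ¬ q ∣ suc a * R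
    q∤[1+a]R q∣ with euclidsLemma (suc a) R q-prime q∣
    ... | inj₁ q∣1+a = ∤-between-multiples {t} (s≤s lo) (≤∧≢⇒< hi 1+a≢) q∣1+a
    ... | inj₂ q∣R   = q∤R q∣R

  carry : ∀ {b c e tb tc ta} → e ≤ 1 → ⌊ b /q⌋≡ tb → ⌊ c /q⌋≡ tc → ⌊ b + c + e /q⌋≡ ta →
          ∃[ e′ ] e′ ≤ 1 × ta ≡ tb + tc + e′
  carry {b} {c} {e} {tb} {tc} {ta} e≤1 (lo-b , hi-b) (lo-c , hi-c) (lo-a , hi-a) =
    ta ∸ (tb + tc) , ≤-trans (∸-monoˡ-≤ (tb + tc) ta≤) (≤-reflexive (m+n∸m≡n (tb + tc) 1)) ,
    sym (m+[n∸m]≡n tb+tc≤)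
    where
    open ≤-Reasoning
    tb+tc≤ : tb + tc ≤ ta
    tb+tc≤ = s≤s⁻¹ (*-cancelʳ-< q (tb + tc) (suc ta) (begin-strict
      (tb + tc) * q      ≡⟨ *-distribʳ-+ q tb tc ⟩
      tb * q + tc * q    ≤⟨ +-mono-≤ lo-b lo-c ⟩
      b + c              ≤⟨ m≤m+n (b + c) e ⟩
      b + c + e          <⟨ hi-a ⟩
      suc ta * q         ∎))
    ta≤ : ta ≤ tb + tc + 1
    ta≤ = s≤s⁻¹ (≤-trans (*-cancelʳ-< q ta (suc (suc (tb + tc))) (begin-strict
      ta * q                       ≤⟨ lo-a ⟩
      b + c + e                    ≤⟨ +-monoʳ-≤ (b + c) e≤1 ⟩
      b + c + 1                    ≡⟨ +-comm (b + c) 1 ⟩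
      suc (b + c)                  <⟨ s≤s (≤-reflexive (sym (+-suc b c))) ⟩
      suc b + suc c                ≤⟨ +-mono-≤ hi-b hi-c ⟩
      suc tb * q + suc tc * q      ≡⟨ *-distribʳ-+ q (suc tb) (suc tc) ⟨
      (suc tb + suc tc) * q        ≡⟨ cong (λ m → suc m * q) (+-suc tb tc) ⟩
      suc (suc (tb + tc)) * q      ∎)) (≤-reflexive (cong suc (+-comm 1 (tb + tc)))))

  record Descent (b c e K : ℕ) : Set where
    constructor descent
    field
      b′ c′ e′ K′ : ℕ
      e′≤1        : e′ ≤ 1
      K′-eq       : K′ * (b′ ! * c′ !) ≡ (b′ + c′ + e′) !
      shrinks     : (b′ + c′ + e′) * q ≤ b + c + e
      valuation   : ∀ {d} → q ^ d ∣ K → q ^ d ∣ q ^ e′ * K′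

  descend : ∀ b c e {K} → e ≤ 1 → K * (b ! * c !) ≡ (b + c + e) ! → Descent b c e K
  descend b c e {K} e≤1 K-eq with factorialSplit b | factorialSplit c | factorialSplit (b + c + e)
  ... | split tb Rb fb b!≡ q∤Rb | split tc Rc fc c!≡ q∤Rc | split ta Ra fa a!≡ q∤Ra with carry e≤1 fb fc fa
  ... | e′ , e′≤1 , refl = descent tb tc e′ K′ e′≤1 (sym K′-eq) (⌊_/q⌋≡_.lower fa) (λ {d} → valuation {d})
    where
    K′∣ = b!*c!∣[b+c+e]! tb tc e′
    K′ = quotient K′∣
    K′-eq : (tb + tc + e′) ! ≡ K′ * (tb ! * tc !)
    K′-eq = m∣n⇒n≡quotient*m K′∣
    instance
      _ : NonZero (q ^ tb * q ^ tc * (tb ! * tc !))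
      _ = m*n≢0 _ _ {{m*n≢0 _ _ {{m^n≢0 q tb}} {{m^n≢0 q tc}}}} {{tb !* tc !≢0}}
    K-eq′ : K * (Rb * Rc) ≡ q ^ e′ * (K′ * Ra)
    K-eq′ = *-cancelʳ-≡ _ _ (q ^ tb * q ^ tc * (tb ! * tc !)) (begin
      K * (Rb * Rc) * (q ^ tb * q ^ tc * (tb ! * tc !))
        ≡⟨ solve 7 (λ k rb rc x y u v → k :* (rb :* rc) :* (x :* y :* (u :* v))
                                      := k :* ((x :* (u :* rb)) :* (y :* (v :* rc))))
                   refl K Rb Rc (q ^ tb) (q ^ tc) (tb !) (tc !) ⟩
      K * ((q ^ tb * (tb ! * Rb)) * (q ^ tc * (tc ! * Rc)))
        ≡⟨ cong₂ (λ u v → K * (u * v)) b!≡ c!≡ ⟨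
      K * (b ! * c !)
        ≡⟨ trans K-eq a!≡ ⟩
      q ^ (tb + tc + e′) * ((tb + tc + e′) ! * Ra)
        ≡⟨ cong₂ (λ u v → u * (v * Ra)) q^[tb+tc+e′] K′-eq ⟩
      q ^ tb * q ^ tc * q ^ e′ * (K′ * (tb ! * tc !) * Ra)
        ≡⟨ solve 7 (λ k ra x y z u v → x :* y :* z :* (k :* (u :* v) :* ra)
                                     := z :* (k :* ra) :* (x :* y :* (u :* v)))
                   refl K′ Ra (q ^ tb) (q ^ tc) (q ^ e′) (tb !) (tc !) ⟩
      q ^ e′ * (K′ * Ra) * (q ^ tb * q ^ tc * (tb ! * tc !))
        ∎)
      where
      open ≡-Reasoning
      q^[tb+tc+e′] : q ^ (tb + tc + e′) ≡ q ^ tb * q ^ tc * q ^ e′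
      q^[tb+tc+e′] = trans (^-distribˡ-+-* q (tb + tc) e′) (cong (_* q ^ e′) (^-distribˡ-+-* q tb tc))
    valuation : ∀ {d} → q ^ d ∣ K → q ^ d ∣ q ^ e′ * K′
    valuation {d} q^d∣K = q^j∣m*r⇒q^j∣m d (q ^ e′ * K′) q∤Ra
      (subst (q ^ d ∣_) (trans K-eq′ (sym (*-assoc (q ^ e′) K′ Ra))) (∣m⇒∣m*n (Rb * Rc) q^d∣K))

  private
    t*q≤a⇒t<a : ∀ {t a} → t * q ≤ a → 0 < a → t < a
    t*q≤a⇒t<a {zero} _ 0<a = 0<a
    t*q≤a⇒t<a {suc t} tq≤a _ = <-≤-trans (m<m*n (suc t) q 1<q) tq≤a

    q∣m!⇒0<m : ∀ m → q ∣ m ! → 0 < m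
    q∣m!⇒0<m zero q∣1 = contradiction q∣1 q∤1
    q∣m!⇒0<m (suc m) _ = s≤s z≤n

  -- Kummer's theorem in disguise: each level of the descent contributes at most one factor q
  -- (the carry e′), and a carry at depth j forces q ^ j ≤ b + c + e.
  prime-power-bound : ∀ b c e {K} j → e ≤ 1 → K * (b ! * c !) ≡ (b + c + e) ! →
                      q ^ suc j ∣ K → q ^ suc j ≤ b + c + e
  prime-power-bound b c e = go b c e (<-wellFounded (b + c + e))
    where
    go : ∀ b c e → Acc _<_ (b + c + e) → ∀ {K} j → e ≤ 1 → K * (b ! * c !) ≡ (b + c + e) ! →
         q ^ suc j ∣ K → q ^ suc j ≤ b + c + e
    go b c e (acc rs) {K} j e≤1 K-eq q^[1+j]∣K = bound (descend b c e e≤1 K-eq)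
      where
      0<a : 0 < b + c + e
      0<a = q∣m!⇒0<m (b + c + e)
              (∣-trans (m*n∣⇒m∣ q (q ^ j) q^[1+j]∣K) (divides (b ! * c !) (trans (sym K-eq) (*-comm K _))))
      bound : Descent b c e K → q ^ suc j ≤ b + c + e
      bound (descent b′ c′ zero K′ _ K′-eq shrinks valuation) = begin
        q ^ suc j              ≤⟨ go b′ c′ 0 (rs (t*q≤a⇒t<a shrinks 0<a)) j z≤n K′-eq q^[1+j]∣K′ ⟩
        b′ + c′ + 0            ≤⟨ m≤m*n (b′ + c′ + 0) q ⟩
        (b′ + c′ + 0) * q      ≤⟨ shrinks ⟩
        b + c + e              ∎
        where
        open ≤-Reasoning
        q^[1+j]∣K′ : q ^ suc j ∣ K′
        q^[1+j]∣K′ = subst (q ^ suc j ∣_) (*-identityˡ K′) (valuation {suc j} q^[1+j]∣K)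
      bound (descent b′ c′ (suc zero) K′ _ K′-eq shrinks valuation) = ≤-trans (q*q^j≤a′*q j q^j∣K′) shrinks
        where
        q^j∣K′ : q ^ j ∣ K′
        q^j∣K′ = *-cancelˡ-∣ q (subst (q * q ^ j ∣_) (cong (_* K′) (*-identityʳ q))
                                      (valuation {suc j} q^[1+j]∣K))
        q*q^j≤a′*q : ∀ j → q ^ j ∣ K′ → q * q ^ j ≤ (b′ + c′ + 1) * q
        q*q^j≤a′*q zero _ = ≤-trans (≤-reflexive (*-comm q 1)) (*-monoˡ-≤ q (m≤n+m 1 (b′ + c′)))
        q*q^j≤a′*q (suc j) q^[1+j]∣K′ =
          ≤-trans (*-monoʳ-≤ q (go b′ c′ 1 (rs (t*q≤a⇒t<a shrinks 0<a)) j ≤-refl K′-eq q^[1+j]∣K′))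
                  (≤-reflexive (*-comm q (b′ + c′ + 1)))
      bound (descent _ _ (suc (suc _)) _ (s≤s ()) _ _ _)

product-split : ∀ p xs → product xs ≡ p ^ length (filter (_≟ p) xs) * product (filter (λ x → ¬? (x ≟ p)) xs)
product-split p [] = refl
product-split p (x ∷ xs) with x ≟ p
... | yes refl
  rewrite filter-accept (_≟ x) {xs = xs} refl | filter-reject (λ y → ¬? (y ≟ x)) {xs = xs} (λ x≢x → x≢x refl)
  = trans (cong (x *_) (product-split x xs)) (sym (*-assoc x _ _))
... | no x≢p
  rewrite filter-reject (_≟ p) {xs = xs} x≢p | filter-accept (λ y → ¬? (y ≟ p)) {xs = xs} x≢p
  = trans (cong (x *_) (product-split p xs)) (x∙yz≈y∙xz x (p ^ length (filter (_≟ p) xs)) _)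

product≤^length : ∀ {B} ps xs → All (_∈ₗ ps) xs → (∀ {p} j → p ∈ₗ ps → p ^ j ∣ product xs → p ^ j ≤ B) →
                  product xs ≤ B ^ length ps
product≤^length [] [] [] _ = ≤-refl
product≤^length {B} (p ∷ ps) xs xs⊆p∷ps bound = begin
  product xs           ≡⟨ product-split p xs ⟩
  p ^ c * product ys   ≤⟨ *-mono-≤ (bound c (here refl) p^c∣xs) (product≤^length ps ys ys⊆ps bound′) ⟩
  B * B ^ length ps    ∎
  where
  open ≤-Reasoning
  c = length (filter (_≟ p) xs)
  ys = filter (λ x → ¬? (x ≟ p)) xs
  p^c∣xs : p ^ c ∣ product xs
  p^c∣xs = subst (p ^ c ∣_) (sym (product-split p xs)) (m∣m*n (product ys))
  ys∣xs : product ys ∣ product xs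
  ys∣xs = subst (product ys ∣_) (sym (product-split p xs)) (n∣m*n (p ^ c))
  bound′ : ∀ {p′} j → p′ ∈ₗ ps → p′ ^ j ∣ product ys → p′ ^ j ≤ B
  bound′ j p′∈ps p′^j∣ys = bound j (there p′∈ps) (∣-trans p′^j∣ys ys∣xs)
  ∈-tail : ∀ {y} → y ∈ₗ p ∷ ps → y ≢ p → y ∈ₗ ps
  ∈-tail (here y≡p)   y≢p = contradiction y≡p y≢p
  ∈-tail (there y∈ps) _   = y∈ps
  ys⊆ps : All (_∈ₗ ps) ys
  ys⊆ps = All.tabulate λ y∈ys → let (y∈xs , y≢p) = ∈-filter⁻ (λ x → ¬? (x ≟ p)) {xs = xs} y∈ys
                                in ∈-tail (All.lookup xs⊆p∷ps y∈xs) y≢p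

2^n≤[n+n]^π : ∀ {n M} → 1 ≤ n → n + n ≤ M → 2 ^ n ≤ (n + n) ^ π M
2^n≤[n+n]^π {n} {M} 1≤n n+n≤M = begin
  2 ^ n          ≤⟨ 2^n≤X ⟩
  X              ≡⟨ isFactorisation ⟩
  product F      ≤⟨ product≤^length (primesUpTo M) F F⊆primes bound ⟩
  (n + n) ^ π M  ∎
  where
  open ≤-Reasoning
  X = (n + n) C n
  X-eq : X * (n ! * n !) ≡ (n + n + 0) !
  X-eq = trans ([n+n]Cn*n!*n!≡[n+n]! n) (cong _! (sym (+-identityʳ (n + n))))
  2^n≤X : 2 ^ n ≤ X
  2^n≤X = *-cancelʳ-≤ (2 ^ n) X (n ! * n !) {{n !* n !≢0}}
            (≤-trans (2^n*n!*n!≤[n+n]! n) (≤-reflexive (sym ([n+n]Cn*n!*n!≡[n+n]! n))))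
  instance
    _ : NonZero X
    _ = >-nonZero (≤-trans (m^n>0 2 n) 2^n≤X)
  open PrimeFactorisation (factorise X) renaming (factors to F)
  p^[1+j]≤n+n : ∀ {p} j → Prime p → p ^ suc j ∣ product F → p ^ suc j ≤ n + n
  p^[1+j]≤n+n {p} j p-prime d = subst (p ^ suc j ≤_) (+-identityʳ (n + n))
    (prime-power-bound p-prime n n 0 j z≤n X-eq (subst (p ^ suc j ∣_) (sym isFactorisation) d))
  bound : ∀ {p} j → p ∈ₗ primesUpTo M → p ^ j ∣ product F → p ^ j ≤ n + n
  bound zero    _  _ = ≤-trans 1≤n (m≤m+n n n)
  bound (suc j) p∈ d = p^[1+j]≤n+n j (proj₁ (∈-primesUpTo⁻ {M} p∈)) d
  f≤n+n : ∀ {f} → f ∈ₗ F → f ≤ n + n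
  f≤n+n {f} f∈F = subst (_≤ n + n) (*-identityʳ f) (p^[1+j]≤n+n 0 (All.lookup factorsPrime f∈F)
                    (subst (_∣ product F) (sym (*-identityʳ f)) (∈⇒∣product f∈F)))
  F⊆primes : All (_∈ₗ primesUpTo M) F
  F⊆primes = All.tabulate λ f∈F → ∈-primesUpTo⁺ (All.lookup factorsPrime f∈F) (≤-trans (f≤n+n f∈F) n+n≤M)

n<2^[1+⌊log₂n⌋] : ∀ n → n < 2 ^ suc ⌊log₂ n ⌋
n<2^[1+⌊log₂n⌋] n = ≰⇒> λ 2^[1+L]≤n →
  1+n≰n (≤-trans (≤-reflexive (sym (⌊log₂[2^n]⌋≡n (suc ⌊log₂ n ⌋)))) (⌊log₂⌋-mono-≤ 2^[1+L]≤n))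

2^m≤2^n⇒m≤n : ∀ {m n} → 2 ^ m ≤ 2 ^ n → m ≤ n
2^m≤2^n⇒m≤n 2^m≤2^n = ≮⇒≥ λ n<m → <⇒≱ (^-monoʳ-< 2 (s≤s (s≤s z≤n)) n<m) 2^m≤2^n

N≤6*⌊log₂N⌋*πN : ∀ N → 2 ≤ N → N ≤ 6 * (⌊log₂ N ⌋ * π N)
N≤6*⌊log₂N⌋*πN N 2≤N = begin
  N                 ≤⟨ N≤1+h+h ⟩
  suc (h + h)       ≤⟨ +-monoˡ-≤ (h + h) 1≤h ⟩
  h + (h + h)       ≡⟨ cong (λ m → h + (h + m)) (+-identityʳ h) ⟨
  3 * h             ≤⟨ *-monoʳ-≤ 3 h≤[1+L]*k ⟩
  3 * (suc L * k)   ≤⟨ *-monoʳ-≤ 3 (*-monoˡ-≤ k (+-monoˡ-≤ L 1≤L)) ⟩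
  3 * ((L + L) * k) ≡⟨ solve 2 (λ L k → con 3 :* ((L :+ L) :* k) := con 6 :* (L :* k)) refl L k ⟩
  6 * (L * k)       ∎
  where
  open ≤-Reasoning
  L = ⌊log₂ N ⌋
  k = π N
  h = N / 2
  1≤L : 1 ≤ L
  1≤L = ⌊log₂⌋-mono-≤ 2≤N
  1≤h : 1 ≤ h
  1≤h = m≥n⇒m/n>0 2≤N
  h+h≤N : h + h ≤ N
  h+h≤N = ≤-trans (≤-reflexive (solve 1 (λ h → h :+ h := h :* con 2) refl h)) (m/n*n≤m N 2)
  N≤1+h+h : N ≤ suc (h + h)
  N≤1+h+h = s≤s⁻¹ (begin-strict
    N                 ≡⟨ m≡m%n+[m/n]*n N 2 ⟩
    N % 2 + h * 2     <⟨ +-monoˡ-< (h * 2) (m%n<n N 2) ⟩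
    2 + h * 2         ≡⟨ cong (2 +_) (solve 1 (λ h → h :* con 2 := h :+ h) refl h) ⟩
    suc (suc (h + h)) ∎)
  h≤[1+L]*k : h ≤ suc L * k
  h≤[1+L]*k = 2^m≤2^n⇒m≤n (begin
    2 ^ h             ≤⟨ 2^n≤[n+n]^π 1≤h h+h≤N ⟩
    (h + h) ^ k       ≤⟨ ^-monoˡ-≤ k (<⇒≤ (≤-<-trans h+h≤N (n<2^[1+⌊log₂n⌋] N))) ⟩
    (2 ^ suc L) ^ k   ≡⟨ ^-*-assoc 2 (suc L) k ⟩
    2 ^ (suc L * k)   ∎)

-- Residues modulo a prime

module _ {p : ℕ} (p-prime : Prime p) where

  private
    instance
      p≢0 : NonZero p
      p≢0 = prime⇒nonZero p-prime

  %≡%⇒∣∸ : ∀ {x y} → y ≤ x → x % p ≡ y % p → p ∣ x ∸ y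
  %≡%⇒∣∸ {x} {y} _ x≡y = divides (x / p ∸ y / p) (begin
    x ∸ y                                        ≡⟨ cong₂ _∸_ (m≡m%n+[m/n]*n x p) (m≡m%n+[m/n]*n y p) ⟩
    (x % p + x / p * p) ∸ (y % p + y / p * p)    ≡⟨ cong (λ r → (r + x / p * p) ∸ (y % p + y / p * p)) x≡y ⟩
    (y % p + x / p * p) ∸ (y % p + y / p * p)    ≡⟨ [m+n]∸[m+o]≡n∸o (y % p) _ _ ⟩
    x / p * p ∸ y / p * p                        ≡⟨ *-distribʳ-∸ p (x / p) (y / p) ⟨
    (x / p ∸ y / p) * p                          ∎)
    where open ≡-Reasoning

  %-*-congˡ : ∀ c {x y} → x % p ≡ y % p → (c * x) % p ≡ (c * y) % p
  %-*-congˡ c {x} {y} x≡y = begin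
    (c * x) % p              ≡⟨ %-distribˡ-* c x p ⟩
    (c % p * (x % p)) % p    ≡⟨ cong (λ r → (c % p * r) % p) x≡y ⟩
    (c % p * (y % p)) % p    ≡⟨ %-distribˡ-* c y p ⟨
    (c * y) % p              ∎
    where open ≡-Reasoning

  private
    ∣∧<⇒≡0 : ∀ {d} → p ∣ d → d < p → d ≡ 0
    ∣∧<⇒≡0 {zero}  _   _   = refl
    ∣∧<⇒≡0 {suc d} p∣d d<p = contradiction (∣⇒≤ p∣d) (<⇒≱ d<p)

    *-cancelʳ-%-≥ : ∀ {m x y} → 0 < m → m < p → (x * m) % p ≡ (y * m) % p → x < y + p → y ≤ x → x ≡ y
    *-cancelʳ-%-≥ {m} {x} {y} 0<m m<p xm≡ym x<y+p y≤x = ≤-antisym (m∸n≡0⇒m≤n x∸y≡0) y≤x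
      where
      p∣[x∸y]*m : p ∣ m * (x ∸ y)
      p∣[x∸y]*m = subst (p ∣_) (trans (sym (*-distribʳ-∸ m x y)) (*-comm (x ∸ y) m))
                        (%≡%⇒∣∸ (*-monoˡ-≤ m y≤x) xm≡ym)
      x∸y≡0 : x ∸ y ≡ 0
      x∸y≡0 = ∣∧<⇒≡0 (coprime-divisor (prime⇒coprime p-prime {{>-nonZero 0<m}} m<p) p∣[x∸y]*m)
                      (m<n+o⇒m∸n<o x y x<y+p)

  *-cancelʳ-% : ∀ {m x y} → 0 < m → m < p → (x * m) % p ≡ (y * m) % p → x < y + p → y < x + p → x ≡ y
  *-cancelʳ-% {x = x} {y = y} 0<m m<p xm≡ym x<y+p y<x+p with ≤-total y x
  ... | inj₁ y≤x = *-cancelʳ-%-≥ 0<m m<p xm≡ym x<y+p y≤x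
  ... | inj₂ x≤y = sym (*-cancelʳ-%-≥ 0<m m<p (sym xm≡ym) y<x+p x≤y)

  *-cancelʳ-%-< : ∀ {m x y} → 0 < m → m < p → x < p → y < p → (x * m) % p ≡ (y * m) % p → x ≡ y
  *-cancelʳ-%-< {x = x} {y} 0<m m<p x<p y<p xm≡ym =
    *-cancelʳ-% 0<m m<p xm≡ym (<-≤-trans x<p (m≤n+m p y)) (<-≤-trans y<p (m≤n+m p x))

/-≡⇒cross< : ∀ a a′ K s s′ .{{_ : NonZero s}} .{{_ : NonZero s′}} →
             (a * K) / s ≡ (a′ * K) / s′ → a * K * s′ < a′ * K * s + s * s′
/-≡⇒cross< a a′ K s s′ same = begin-strict
  a * K * s′              <⟨ *-monoˡ-< s′ aK<[1+b]s ⟩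
  suc b * s * s′          ≡⟨ solve 3 (λ b s s′ → (con 1 :+ b) :* s :* s′ := b :* s′ :* s :+ s :* s′)
                                    refl b s s′ ⟩
  b * s′ * s + s * s′     ≤⟨ +-monoˡ-≤ (s * s′) (*-monoˡ-≤ s bs′≤a′K) ⟩
  a′ * K * s + s * s′     ∎
  where
  open ≤-Reasoning
  b = (a * K) / s
  aK<[1+b]s : a * K < suc b * s
  aK<[1+b]s = begin-strict
    a * K                    ≡⟨ m≡m%n+[m/n]*n (a * K) s ⟩
    (a * K) % s + b * s      <⟨ +-monoˡ-< (b * s) (m%n<n (a * K) s) ⟩
    s + b * s                ∎
  bs′≤a′K : b * s′ ≤ a′ * K
  bs′≤a′K = subst (λ c → c * s′ ≤ a′ * K) (sym same) (m/n*n≤m (a′ * K) s′)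

slope-close : ∀ {N K p} a b a′ b′ .{{_ : NonZero (a + b)}} .{{_ : NonZero (a′ + b′)}} →
              (N + N) * (N + N) < K * p → a ≤ N → b ≤ N → a′ ≤ N → b′ ≤ N →
              (a * K) / (a + b) ≡ (a′ * K) / (a′ + b′) → a * b′ < a′ * b + p
slope-close {N} {K} {p} a b a′ b′ [N+N]²<Kp a≤N b≤N a′≤N b′≤N same =
  *-cancelˡ-< K (a * b′) (a′ * b + p) (begin-strict
    K * (a * b′)            <⟨ +-cancelˡ-< (K * (a * a′)) _ _ cross ⟩
    K * (a′ * b) + s * s′   <⟨ +-monoʳ-< (K * (a′ * b)) (≤-<-trans ss′≤[N+N]² [N+N]²<Kp) ⟩
    K * (a′ * b) + K * p    ≡⟨ *-distribˡ-+ K (a′ * b) p ⟨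
    K * (a′ * b + p)        ∎)
  where
  open ≤-Reasoning
  s = a + b
  s′ = a′ + b′
  ss′≤[N+N]² : s * s′ ≤ (N + N) * (N + N)
  ss′≤[N+N]² = *-mono-≤ (+-mono-≤ a≤N b≤N) (+-mono-≤ a′≤N b′≤N)
  cross : K * (a * a′) + K * (a * b′) < K * (a * a′) + (K * (a′ * b) + s * s′)
  cross = begin-strict
    K * (a * a′) + K * (a * b′)
      ≡⟨ solve 4 (λ K a a′ b′ → K :* (a :* a′) :+ K :* (a :* b′) := a :* K :* (a′ :+ b′)) refl K a a′ b′ ⟩
    a * K * s′
      <⟨ /-≡⇒cross< a a′ K s s′ same ⟩
    a′ * K * s + s * s′
      ≡⟨ solve 5 (λ K a b a′ x → a′ :* K :* (a :+ b) :+ x := K :* (a :* a′) :+ (K :* (a′ :* b) :+ x))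
                 refl K a b a′ (s * s′) ⟩
    K * (a * a′) + (K * (a′ * b) + s * s′)
      ∎

mod-injective : ∀ {m m′ n} .{{_ : NonZero n}} → m < n → m′ < n → m mod n ≡ m′ mod n → m ≡ m′
mod-injective {m} {m′} {n} m<n m′<n eq = begin
  m        ≡⟨ m<n⇒m%n≡m m<n ⟨
  m % n    ≡⟨ fromℕ<-injective (m % n) (m′ % n) (m%n<n m n) (m%n<n m′ n) eq ⟩
  m′ % n   ≡⟨ m<n⇒m%n≡m m′<n ⟩
  m′       ∎
  where open ≡-Reasoning

prime∣prime⇒≡ : ∀ {a b} → Prime a → Prime b → a ∣ b → a ≡ b
prime∣prime⇒≡ a-prime b-prime a∣b with prime⇒irreducible b-prime a∣b
... | inj₁ refl = contradiction a-prime ¬prime[1]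
... | inj₂ a≡b  = a≡b

-- Dilates of the small primes

module _ {p : ℕ} (p-prime : Prime p) where

  private
    instance
      p≢0 : NonZero p
      p≢0 = prime⇒nonZero p-prime

  _·_ : ℕ → Fin p → Fin p
  q · y = (q * toℕ y) mod p

  ·≡·⇒%≡% : ∀ {q y q′ y′} → q · y ≡ q′ · y′ → (q * toℕ y) % p ≡ (q′ * toℕ y′) % p
  ·≡·⇒%≡% eq = trans (sym (toℕ-fromℕ< _)) (trans (cong toℕ eq) (toℕ-fromℕ< _))

  cross-% : ∀ q₁ q₂ q₁′ q₂′ {y y′} → q₁ · y ≡ q₂ · y′ → q₁′ · y ≡ q₂′ · y′ →
            (q₁ * q₂′ * toℕ y) % p ≡ (q₁′ * q₂ * toℕ y) % p
  cross-% q₁ q₂ q₁′ q₂′ {y} {y′} c c′ = begin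
    (q₁ * q₂′ * toℕ y) % p      ≡⟨ cong (_% p) (x∙yz≈y∙xz′ q₁ q₂′ (toℕ y)) ⟩
    (q₂′ * (q₁ * toℕ y)) % p    ≡⟨ %-*-congˡ p-prime q₂′ (·≡·⇒%≡% {q₁} {y} {q₂} {y′} c) ⟩
    (q₂′ * (q₂ * toℕ y′)) % p   ≡⟨ cong (_% p) (x∙yz≈y∙xz q₂′ q₂ (toℕ y′)) ⟩
    (q₂ * (q₂′ * toℕ y′)) % p   ≡⟨ %-*-congˡ p-prime q₂ (·≡·⇒%≡% {q₁′} {y} {q₂′} {y′} c′) ⟨
    (q₂ * (q₁′ * toℕ y)) % p    ≡⟨ cong (_% p) (x∙yz≈y∙xz′ q₁′ q₂ (toℕ y)) ⟨
    (q₁′ * q₂ * toℕ y) % p      ∎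
    where
    open ≡-Reasoning
    x∙yz≈y∙xz′ : ∀ a b c → a * b * c ≡ b * (a * c)
    x∙yz≈y∙xz′ a b c = trans (cong (_* c) (*-comm a b)) (*-assoc b a c)

  ·∈prodSet : ∀ {N M q y} → 0 < q → q ≤ N → y ∈ M → q · y ∈ prodSet p N M
  ·∈prodSet {N} {M} {suc q} {y} _ q<N y∈M = lookup⇒[]= (suc q · y) (prodSet p N M)
    (trans (lookup∘tabulate _ (suc q · y)) (Equivalence.to T-≡
      (any⁺ _ (lose (∈-applyUpTo⁺ suc q<N)
        (any⁺ _ (lose (∈-allFin y)
          (Equivalence.from T-∧ (Equivalence.from T-≡ ([]=⇒lookup y∈M) , fromWitness refl))))))))

  module _ {N : ℕ} (N<p : N < p) where

    private
      A = primesUpTo N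

      ∈A⇒prime : ∀ {q} → q ∈ₗ A → Prime q
      ∈A⇒prime q∈A = proj₁ (∈-primesUpTo⁻ {N} q∈A)

      ∈A⇒0<q : ∀ {q} → q ∈ₗ A → 0 < q
      ∈A⇒0<q {q} q∈A = >-nonZero⁻¹ q {{prime⇒nonZero (∈A⇒prime q∈A)}}

      ∈A⇒q≤N : ∀ {q} → q ∈ₗ A → q ≤ N
      ∈A⇒q≤N q∈A = proj₂ (∈-primesUpTo⁻ {N} q∈A)

      ∈A⇒q<p : ∀ {q} → q ∈ₗ A → q < p
      ∈A⇒q<p q∈A = ≤-<-trans (∈A⇒q≤N q∈A) N<p

      A-unique : Unique A
      A-unique = primesUpTo-unique N

    dilate : Fin p → Subset p
    dilate y = image (_· y) A

    dilate⊆prodSet : ∀ {M y} → y ∈ M → dilate y ⊆ prodSet p N M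
    dilate⊆prodSet {y = y} y∈M z∈dilate with ∈-image⁻ (_· y) A z∈dilate
    ... | q , q∈A , refl = ·∈prodSet (∈A⇒0<q q∈A) (∈A⇒q≤N q∈A) y∈M

    π≤∣dilate∣ : ∀ {y} → toℕ y ≢ 0 → π N ≤ ∣ dilate y ∣
    π≤∣dilate∣ {y} y≢0 = length≤∣image∣ (_· y) A-unique λ {q} {q′} q∈A q′∈A q·y≡q′·y →
      *-cancelʳ-%-< p-prime (n≢0⇒n>0 y≢0) (toℕ<n y) (∈A⇒q<p q∈A) (∈A⇒q<p q′∈A)
                    (·≡·⇒%≡% {q} {y} {q′} {y} q·y≡q′·y)

    module _ (K : ℕ) .{{_ : NonZero K}} ([N+N]²<Kp : (N + N) * (N + N) < K * p) where

      -- Which of the K subintervals of [0, 1] of length 1/K contains q₁/(q₁ + q₂); the first clause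
      -- is a junk value, never met since q₁ is prime.
      slope : ℕ × ℕ → ℕ
      slope (zero  , _) = 0
      slope (suc a , b) = (suc a * K) / (suc a + b)

      slope<K : ∀ {a b} → 0 < b → slope (a , b) < K
      slope<K {zero}  _   = >-nonZero⁻¹ K
      slope<K {suc a} {b} 0<b =
        m<n*o⇒m/o<n (subst (_< K * (suc a + b)) (*-comm K (suc a)) (*-monoʳ-< K (m<m+n (suc a) 0<b)))

      same-slope⇒close : ∀ {a b a′ b′} → a ∈ₗ A → b ∈ₗ A → a′ ∈ₗ A → b′ ∈ₗ A →
                         slope (a , b) ≡ slope (a′ , b′) → a * b′ < a′ * b + p
      same-slope⇒close {zero} a∈A _ _ _ _ = contradiction (∈A⇒0<q a∈A) λ ()
      same-slope⇒close {suc _} {a′ = zero} _ _ a′∈A _ _ = contradiction (∈A⇒0<q a′∈A) λ ()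
      same-slope⇒close {a@(suc _)} {b} {a′@(suc _)} {b′} a∈A b∈A a′∈A b′∈A =
        slope-close {N} {K} {p} a b a′ b′ [N+N]²<Kp (∈A⇒q≤N a∈A) (∈A⇒q≤N b∈A) (∈A⇒q≤N a′∈A) (∈A⇒q≤N b′∈A)

      module _ {y y′ : Fin p} (y≢0 : toℕ y ≢ 0) (y′≢0 : toℕ y′ ≢ 0) (y≢y′ : y ≢ y′) where

        slope-injective : ∀ {q₁ q₂ q₁′ q₂′} → q₁ ∈ₗ A → q₂ ∈ₗ A → q₁′ ∈ₗ A → q₂′ ∈ₗ A →
                          q₁ · y ≡ q₂ · y′ → q₁′ · y ≡ q₂′ · y′ →
                          slope (q₁ , q₂) ≡ slope (q₁′ , q₂′) → q₁ ≡ q₁′ × q₂ ≡ q₂′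
        slope-injective {q₁} {q₂} {q₁′} {q₂′} q₁∈A q₂∈A q₁′∈A q₂′∈A c c′ same = q₁≡q₁′ , q₂≡q₂′
          where
          q₁q₂′≡q₁′q₂ : q₁ * q₂′ ≡ q₁′ * q₂
          q₁q₂′≡q₁′q₂ = *-cancelʳ-% p-prime (n≢0⇒n>0 y≢0) (toℕ<n y) (cross-% q₁ q₂ q₁′ q₂′ c c′)
            (same-slope⇒close q₁∈A q₂∈A q₁′∈A q₂′∈A same) (same-slope⇒close q₁′∈A q₂′∈A q₁∈A q₂∈A (sym same))
          q₁≢q₂ : q₁ ≢ q₂
          q₁≢q₂ refl = y≢y′ (toℕ-injective (*-cancelʳ-%-< p-prime (∈A⇒0<q q₁∈A) (∈A⇒q<p q₁∈A) (toℕ<n y) (toℕ<n y′)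
            (trans (cong (_% p) (*-comm (toℕ y) q₁))
                   (trans (·≡·⇒%≡% {q₁} {y} {q₁} {y′} c) (cong (_% p) (*-comm q₁ (toℕ y′)))))))
          q₁≡q₁′ : q₁ ≡ q₁′
          q₁≡q₁′ with euclidsLemma q₁′ q₂ (∈A⇒prime q₁∈A) (divides q₂′ (trans (sym q₁q₂′≡q₁′q₂) (*-comm q₁ q₂′)))
          ... | inj₁ q₁∣q₁′ = prime∣prime⇒≡ (∈A⇒prime q₁∈A) (∈A⇒prime q₁′∈A) q₁∣q₁′
          ... | inj₂ q₁∣q₂  = contradiction (prime∣prime⇒≡ (∈A⇒prime q₁∈A) (∈A⇒prime q₂∈A) q₁∣q₂) q₁≢q₂
          q₂≡q₂′ : q₂ ≡ q₂′
          q₂≡q₂′ = *-cancelʳ-%-< p-prime (n≢0⇒n>0 y′≢0) (toℕ<n y′) (∈A⇒q<p q₂∈A) (∈A⇒q<p q₂′∈A) (begin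
            (q₂ * toℕ y′) % p     ≡⟨ ·≡·⇒%≡% {q₁} {y} {q₂} {y′} c ⟨
            (q₁ * toℕ y) % p      ≡⟨ cong (λ q → (q * toℕ y) % p) q₁≡q₁′ ⟩
            (q₁′ * toℕ y) % p     ≡⟨ ·≡·⇒%≡% {q₁′} {y} {q₂′} {y′} c′ ⟩
            (q₂′ * toℕ y′) % p    ∎)
            where open ≡-Reasoning

        Coincident : ℕ × ℕ → Set
        Coincident (q₁ , q₂) = q₁ · y ≡ q₂ · y′

        coincident? : ∀ c → Dec (Coincident c)
        coincident? (q₁ , q₂) = q₁ · y ≟ᶠ q₂ · y′

        coincidences : List (ℕ × ℕ)
        coincidences = filter coincident? (cartesianProduct A A)

        coincidences-unique : Unique coincidences
        coincidences-unique = Unique.filter⁺ coincident? (Unique.cartesianProduct⁺ A-unique A-unique)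

        ∈-coincidences⁻ : ∀ {q₁ q₂} → (q₁ , q₂) ∈ₗ coincidences → q₁ ∈ₗ A × q₂ ∈ₗ A × q₁ · y ≡ q₂ · y′
        ∈-coincidences⁻ c∈ with ∈-filter⁻ coincident? {xs = cartesianProduct A A} c∈
        ... | c∈A×A , c-eq with ∈-cartesianProduct⁻ A A c∈A×A
        ...   | q₁∈A , q₂∈A = q₁∈A , q₂∈A , c-eq

        dilate∩dilate⊆image : dilate y ∩ dilate y′ ⊆ image ((_· y) ∘ proj₁) coincidences
        dilate∩dilate⊆image z∈∩ with x∈p∩q⁻ (dilate y) (dilate y′) z∈∩
        ... | z∈y , z∈y′ with ∈-image⁻ (_· y) A z∈y | ∈-image⁻ (_· y′) A z∈y′
        ...   | q₁ , q₁∈A , refl | q₂ , q₂∈A , c-eq =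
          ∈-image⁺ ((_· y) ∘ proj₁) (∈-filter⁺ coincident? (∈-cartesianProduct⁺ q₁∈A q₂∈A) c-eq)

        bucket : ℕ × ℕ → Fin K
        bucket c = slope c mod K

        bucket-injective : ∀ {c c′} → c ∈ₗ coincidences → c′ ∈ₗ coincidences → bucket c ≡ bucket c′ → c ≡ c′
        bucket-injective {q₁ , q₂} {q₁′ , q₂′} c∈ c′∈ same-bucket
          with q₁∈A , q₂∈A , c-eq ← ∈-coincidences⁻ c∈ | q₁′∈A , q₂′∈A , c′-eq ← ∈-coincidences⁻ c′∈
          with q₁≡q₁′ , q₂≡q₂′ ← slope-injective q₁∈A q₂∈A q₁′∈A q₂′∈A c-eq c′-eq
                 (mod-injective (slope<K {q₁} (∈A⇒0<q q₂∈A)) (slope<K {q₁′} (∈A⇒0<q q₂′∈A)) same-bucket)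
          = cong₂ _,_ q₁≡q₁′ q₂≡q₂′

        ∣dilate∩dilate∣≤K : ∣ dilate y ∩ dilate y′ ∣ ≤ K
        ∣dilate∩dilate∣≤K = begin
          ∣ dilate y ∩ dilate y′ ∣                 ≤⟨ p⊆q⇒∣p∣≤∣q∣ dilate∩dilate⊆image ⟩
          ∣ image ((_· y) ∘ proj₁) coincidences ∣  ≤⟨ ∣image∣≤length ((_· y) ∘ proj₁) coincidences ⟩
          length coincidences                      ≤⟨ length≤∣image∣ bucket coincidences-unique bucket-injective ⟩
          ∣ image bucket coincidences ∣            ≤⟨ ∣p∣≤n (image bucket coincidences) ⟩
          K                                        ∎
          where open ≤-Reasoning

slopeBuckets : (p N : ℕ) .{{_ : NonZero p}} → ℕ
slopeBuckets p N = suc ((N + N) * (N + N) / p)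

[N+N]²<K*p : ∀ p N .{{_ : NonZero p}} → (N + N) * (N + N) < slopeBuckets p N * p
[N+N]²<K*p p N = begin-strict
  X                   ≡⟨ m≡m%n+[m/n]*n X p ⟩
  X % p + X / p * p   <⟨ +-monoˡ-< (X / p * p) (m%n<n X p) ⟩
  p + X / p * p       ∎
  where
  open ≤-Reasoning
  X = (N + N) * (N + N)

K*[p⊓N²]≤5N² : ∀ p N .{{_ : NonZero p}} → slopeBuckets p N * (p ⊓ (N * N)) ≤ 5 * (N * N)
K*[p⊓N²]≤5N² p N with ≤-total p (N * N)
... | inj₁ p≤N² = begin
  slopeBuckets p N * (p ⊓ (N * N))   ≡⟨ cong (slopeBuckets p N *_) (m≤n⇒m⊓n≡m p≤N²) ⟩
  p + X / p * p                      ≤⟨ +-mono-≤ p≤N² (m/n*n≤m X p) ⟩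
  N * N + X                          ≡⟨ solve 1 (λ N → N :* N :+ (N :+ N) :* (N :+ N) := con 5 :* (N :* N))
                                               refl N ⟩
  5 * (N * N)                        ∎
  where
  open ≤-Reasoning
  X = (N + N) * (N + N)
... | inj₂ N²≤p = begin
  slopeBuckets p N * (p ⊓ (N * N))   ≡⟨ cong (slopeBuckets p N *_) (m≥n⇒m⊓n≡n N²≤p) ⟩
  slopeBuckets p N * (N * N)         ≤⟨ *-monoˡ-≤ (N * N) (m<n*o⇒m/o<n {(N + N) * (N + N)} {5} {p} X<5p) ⟩
  5 * (N * N)                        ∎
  where
  open ≤-Reasoning
  X<5p : (N + N) * (N + N) < 5 * p
  X<5p = begin-strict
    (N + N) * (N + N)   ≡⟨ solve 1 (λ N → (N :+ N) :* (N :+ N) := con 4 :* (N :* N)) refl N ⟩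
    4 * (N * N)         ≤⟨ *-monoʳ-≤ 4 N²≤p ⟩
    4 * p               <⟨ m<m+n (4 * p) (>-nonZero⁻¹ p) ⟩
    4 * p + p           ≡⟨ solve 1 (λ p → con 4 :* p :+ p := con 5 :* p) refl p ⟩
    5 * p               ∎

r*k≤2*T : ∀ r k K T → r * (2 * K) ≤ k → r * k ≤ T + r * (r * K) → r * k ≤ 2 * T
r*k≤2*T r k K T r*2K≤k r*k≤T+r*r*K = +-cancelʳ-≤ (r * k) (r * k) (2 * T) (begin
  r * k + r * k                          ≤⟨ +-mono-≤ r*k≤T+r*r*K r*k≤T+r*r*K ⟩
  T + r * (r * K) + (T + r * (r * K))    ≡⟨ solve 3 (λ r K T → T :+ r :* (r :* K) :+ (T :+ r :* (r :* K))
                                                          := con 2 :* T :+ r :* (r :* (con 2 :* K))) refl r K T ⟩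
  2 * T + r * (r * (2 * K))              ≤⟨ +-monoʳ-≤ (2 * T) (*-monoʳ-≤ r r*2K≤k) ⟩
  2 * T + r * k                          ∎)
  where open ≤-Reasoning

[1+r]*k≤4*T : ∀ r k T → r * k ≤ 2 * T → (r ≡ 0 → k ≤ T) → suc r * k ≤ 4 * T
[1+r]*k≤4*T zero k T _ k≤T = begin
  k + 0      ≡⟨ +-identityʳ k ⟩
  k          ≤⟨ k≤T refl ⟩
  T          ≤⟨ m≤n*m T 4 ⟩
  4 * T      ∎
  where open ≤-Reasoning
[1+r]*k≤4*T (suc r) k T [1+r]k≤2T _ = begin
  k + suc r * k              ≤⟨ +-monoˡ-≤ (suc r * k) (m≤m+n k (r * k)) ⟩
  suc r * k + suc r * k      ≤⟨ +-mono-≤ [1+r]k≤2T [1+r]k≤2T ⟩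
  2 * T + 2 * T              ≡⟨ solve 1 (λ T → con 2 :* T :+ con 2 :* T := con 4 :* T) refl T ⟩
  4 * T                      ∎
  where open ≤-Reasoning

k*k≤8*K*T : ∀ r k K T → k < suc r * (2 * K) → suc r * k ≤ 4 * T → k * k ≤ 8 * K * T
k*k≤8*K*T r k K T k<[1+r]2K [1+r]k≤4T = begin
  k * k                      ≤⟨ *-monoˡ-≤ k (<⇒≤ k<[1+r]2K) ⟩
  suc r * (2 * K) * k        ≡⟨ solve 3 (λ r K k → r :* (con 2 :* K) :* k := con 2 :* K :* (r :* k))
                                       refl (suc r) K k ⟩
  2 * K * (suc r * k)        ≤⟨ *-monoʳ-≤ (2 * K) [1+r]k≤4T ⟩
  2 * K * (4 * T)            ≡⟨ solve 2 (λ K T → con 2 :* K :* (con 4 :* T) := con 8 :* K :* T) refl K T ⟩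
  8 * K * T                  ∎
  where open ≤-Reasoning

saturated-bound : ∀ {N m L k T} → N ≤ 6 * (L * k) → m * k ≤ 2 * T → N * m * L ≤ 12 * (L * L) * T
saturated-bound {N} {m} {L} {k} {T} N≤6Lk mk≤2T = begin
  N * m * L                  ≤⟨ *-monoˡ-≤ L (*-monoˡ-≤ m N≤6Lk) ⟩
  6 * (L * k) * m * L        ≡⟨ solve 3 (λ L k m → con 6 :* (L :* k) :* m :* L := con 6 :* (L :* L) :* (m :* k))
                                       refl L k m ⟩
  6 * (L * L) * (m * k)      ≤⟨ *-monoʳ-≤ (6 * (L * L)) mk≤2T ⟩
  6 * (L * L) * (2 * T)      ≡⟨ solve 2 (λ L T → con 6 :* (L :* L) :* (con 2 :* T) := con 12 :* (L :* L) :* T)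
                                       refl L T ⟩
  12 * (L * L) * T           ∎
  where open ≤-Reasoning

sparse-bound : ∀ {m N L k K T} → 0 < k → N ≤ 6 * (L * k) → K * m ≤ 5 * (N * N) → k * k ≤ 8 * K * T →
               m ≤ 1440 * (L * L) * T
sparse-bound {m} {N} {L} {k} {K} {T} 0<k N≤6Lk Km≤5N² k²≤8KT =
  *-cancelʳ-≤ m (1440 * (L * L) * T) (k * k) {{m*n≢0 k k {{>-nonZero 0<k}} {{>-nonZero 0<k}}}} (begin
    m * (k * k)
      ≤⟨ *-monoʳ-≤ m k²≤8KT ⟩
    m * (8 * K * T)
      ≡⟨ solve 3 (λ m K T → m :* (con 8 :* K :* T) := con 8 :* T :* (K :* m)) refl m K T ⟩
    8 * T * (K * m)
      ≤⟨ *-monoʳ-≤ (8 * T) Km≤5N² ⟩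
    8 * T * (5 * (N * N))
      ≤⟨ *-monoʳ-≤ (8 * T) (*-monoʳ-≤ 5 (*-mono-≤ N≤6Lk N≤6Lk)) ⟩
    8 * T * (5 * (6 * (L * k) * (6 * (L * k))))
      ≡⟨ solve 3 (λ T L k → con 8 :* T :* (con 5 :* (con 6 :* (L :* k) :* (con 6 :* (L :* k))))
                         := con 1440 :* (L :* L) :* T :* (k :* k)) refl T L k ⟩
    1440 * (L * L) * T * (k * k)
      ∎)
  where open ≤-Reasoning

-- Use r = min(m, ⌊k/2K⌋) dilates; for such r Bonferroni loses at most half, so r k ≤ 2 T.
endgame : ∀ {p N L k m T K} .{{_ : NonZero K}} → 2 ≤ N → N ≤ 6 * (L * k) → K * (p ⊓ (N * N)) ≤ 5 * (N * N) →
          (∀ r → r ≤ m → r * k ≤ T + r * (r * K)) → (1 ≤ m → k ≤ T) →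
          (p ⊓ (N * N)) ⊓ (N * m * L) ≤ 1440 * (L * L) * T
endgame {p} {N} {L} {k} {m} {T} {K} 2≤N N≤6Lk K[p⊓N²]≤5N² r*k≤T+r*r*K k≤T with m * (2 * K) ≤? k
... | yes m*2K≤k = begin
  (p ⊓ (N * N)) ⊓ (N * m * L)   ≤⟨ m⊓n≤n (p ⊓ (N * N)) (N * m * L) ⟩
  N * m * L                     ≤⟨ saturated-bound N≤6Lk (r*k≤2*T m k K T m*2K≤k (r*k≤T+r*r*K m ≤-refl)) ⟩
  12 * (L * L) * T              ≤⟨ *-monoˡ-≤ T (*-monoˡ-≤ (L * L) (m≤m+n 12 1428)) ⟩
  1440 * (L * L) * T            ∎
  where open ≤-Reasoning
... | no m*2K≰k = begin
  (p ⊓ (N * N)) ⊓ (N * m * L)   ≤⟨ m⊓n≤m (p ⊓ (N * N)) (N * m * L) ⟩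
  p ⊓ (N * N)                   ≤⟨ sparse-bound {L = L} {K = K} {T = T} 0<k N≤6Lk K[p⊓N²]≤5N² k*k≤8KT ⟩
  1440 * (L * L) * T            ∎
  where
  open ≤-Reasoning
  instance
    _ : NonZero (2 * K)
    _ = m*n≢0 2 K
  r = k / (2 * K)
  r*2K≤k : r * (2 * K) ≤ k
  r*2K≤k = m/n*n≤m k (2 * K)
  k<[1+r]*2K : k < suc r * (2 * K)
  k<[1+r]*2K = begin-strict
    k                           ≡⟨ m≡m%n+[m/n]*n k (2 * K) ⟩
    k % (2 * K) + r * (2 * K)   <⟨ +-monoˡ-< (r * (2 * K)) (m%n<n k (2 * K)) ⟩
    suc r * (2 * K)             ∎
  r<m : r < m
  r<m = *-cancelʳ-< (2 * K) r m (≤-<-trans r*2K≤k (≰⇒> m*2K≰k))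
  k*k≤8KT : k * k ≤ 8 * K * T
  k*k≤8KT = k*k≤8*K*T r k K T k<[1+r]*2K ([1+r]*k≤4*T r k T (r*k≤2*T r k K T r*2K≤k (r*k≤T+r*r*K r (<⇒≤ r<m)))
                                                           (λ r≡0 → k≤T (subst (_< m) r≡0 r<m)))
  0<k : 0 < k
  0<k = n≢0⇒n>0 λ k≡0 → <⇒≱ 2≤N (begin
    N              ≤⟨ N≤6Lk ⟩
    6 * (L * k)    ≡⟨ cong (λ k → 6 * (L * k)) k≡0 ⟩
    6 * (L * 0)    ≡⟨ cong (6 *_) (*-zeroʳ L) ⟩
    0              <⟨ z<s ⟩
    1              ∎)

module _ {p : ℕ} (p-prime : Prime p) {N : ℕ} (N<p : N < p) {M : Subset p}
         (M≢0 : ∀ m → m ∈ M → toℕ m ≢ 0) where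

  private
    instance
      p≢0 : NonZero p
      p≢0 = prime⇒nonZero p-prime

    K = slopeBuckets p N
    dilateᴹ = dilate p-prime N<p

  π≤∣prodSet∣ : 1 ≤ ∣ M ∣ → π N ≤ ∣ prodSet p N M ∣
  π≤∣prodSet∣ 1≤∣M∣ with y , y∈M ← 0<∣p∣⇒nonempty 1≤∣M∣ =
    ≤-trans (π≤∣dilate∣ p-prime N<p (M≢0 y y∈M)) (p⊆q⇒∣p∣≤∣q∣ (dilate⊆prodSet p-prime N<p y∈M))

  r*π≤∣prodSet∣+r*r*K : ∀ r → r ≤ ∣ M ∣ → r * π N ≤ ∣ prodSet p N M ∣ + r * (r * K)
  r*π≤∣prodSet∣+r*r*K r r≤∣M∣ = subst (λ s → s * π N ≤ ∣ prodSet p N M ∣ + s * (s * K)) length-Bs (begin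
    length Bs * π N                                  ≤⟨ bonferroni Bs π≤∣B∣ overlaps ⟩
    ∣ ⋃ Bs ∣ + length Bs * (length Bs * K)           ≤⟨ +-monoˡ-≤ _ (p⊆q⇒∣p∣≤∣q∣ ⋃Bs⊆prodSet) ⟩
    ∣ prodSet p N M ∣ + length Bs * (length Bs * K)  ∎)
    where
    open ≤-Reasoning
    ys = take r (elements M)
    Bs = map dilateᴹ ys
    ys⊆M : All (_∈ M) ys
    ys⊆M = All.take⁺ r (All.tabulate ∈-elements⁻)
    ys-unique : Unique ys
    ys-unique = Unique.take⁺ r (elements-unique M)
    length-Bs : length Bs ≡ r
    length-Bs = trans (length-map dilateᴹ ys) (trans (length-take r (elements M))
                      (trans (cong (r ⊓_) (length-elements M)) (m≤n⇒m⊓n≡m r≤∣M∣)))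
    ⋃Bs⊆prodSet : ⋃ Bs ⊆ prodSet p N M
    ⋃Bs⊆prodSet = ⋃-least (All.map⁺ (All.map (dilate⊆prodSet p-prime N<p) ys⊆M))
    π≤∣B∣ : All (λ B → π N ≤ ∣ B ∣) Bs
    π≤∣B∣ = All.map⁺ (All.map (λ {y} y∈M → π≤∣dilate∣ p-prime N<p (M≢0 y y∈M)) ys⊆M)
    pairwise : ∀ {zs} → All (_∈ M) zs → Unique zs → AllPairs (λ y y′ → ∣ dilateᴹ y ∩ dilateᴹ y′ ∣ ≤ K) zs
    pairwise [] [] = []
    pairwise {y ∷ _} (y∈M ∷ zs⊆M) (y∉zs ∷ zs-unique) =
      All.zipWith (λ {y′} (y′∈M , y≢y′) → ∣dilate∩dilate∣≤K p-prime N<p K ([N+N]²<K*p p N)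
                                                              (M≢0 y y∈M) (M≢0 y′ y′∈M) y≢y′)
                  (zs⊆M , y∉zs)
      ∷ pairwise zs⊆M zs-unique
    overlaps : AllPairs (λ B B′ → ∣ B ∩ B′ ∣ ≤ K) Bs
    overlaps = AllPairs.map⁺ (pairwise ys⊆M ys-unique)

theorem5 : ∃[ C ] ((p : ℕ) .{{_ : NonZero p}} → Prime p →
               (M : Subset p) → (∀ m → m ∈ M → toℕ m ≢ 0) →
               (N : ℕ) → 2 ≤ N → N < p →
               (p ⊓ (N * N)) ⊓ (N * ∣ M ∣ * ⌊log₂ N ⌋)
                 ≤ C * (⌊log₂ N ⌋ * ⌊log₂ N ⌋) * ∣ prodSet p N M ∣)
theorem5 = 1440 , λ p p-prime M M≢0 N 2≤N N<p →
  endgame 2≤N (N≤6*⌊log₂N⌋*πN N 2≤N) (K*[p⊓N²]≤5N² p N {{prime⇒nonZero p-prime}})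
          (r*π≤∣prodSet∣+r*r*K p-prime N<p M≢0) (π≤∣prodSet∣ p-prime N<p M≢0)
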